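{- The variety of Gödel algebras (equivalently, Gödel–Dummett logic, with formulas identified up to logical equivalence) has unitary e-generalization type.
   Context: Gödel algebras are the subvariety of Heyting algebras (language $\wedge,\vee,\to,0,1$) generated by totally ordered Heyting algebras; they are the equivalent algebraic semantics of Gödel–Dummett logic. Symbolic e-generalization for a variety $\mathsf V$: a problem is a finite multiset $\{t_1,\ldots,t_m\}$ of terms; a solution is a term $s$ with substitutions $\sigma_k$ such that $\mathsf V\models\sigma_k(s)\approx t_k$ for all $k$; $s\preceq u$ iff $\sigma(u)=s$ in $\mathsf V$ for some substitution $\sigma$. A minimal complete set in the poset of solutions (modulo equal generality) is a set of pairwise incomparable solutions below which... more precisely such that every solution lies above one of its elements; a problem is unitary if there is one of cardinality 1. $\mathsf V$ has unitary type if every problem is unitary. -}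

module Defs where

open import Level using (0ℓ)
open import Data.Nat using (ℕ)
open import Data.List using (List; _∷_)
open import Data.List.Relation.Unary.All using (All)
open import Data.Product using (Σ; _×_; ∃)
open import Relation.Binary.Definitions using (Total)
open import Relation.Binary.Lattice.Bundles using (HeytingAlgebra)

data Term : Set where
  var  : ℕ → Term
  `0   : Term
  `1   : Term
  _`∧_ : Term → Term → Term
  _`∨_ : Term → Term → Term
  _`→_ : Term → Term → Term

Subst : Set
Subst = ℕ → Term

_[_] : Term → Subst → Term
var x [ σ ]    = σ x
`0 [ σ ]       = `0
`1 [ σ ]       = `1
(s `∧ t) [ σ ] = (s [ σ ]) `∧ (t [ σ ])
(s `∨ t) [ σ ] = (s [ σ ]) `∨ (t [ σ ])
(s `→ t) [ σ ] = (s [ σ ]) `→ (t [ σ ])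

-- Totally ordered Heyting algebras (Gödel chains); these generate the
-- variety of Gödel algebras.
record GodelChain : Set₁ where
  field
    algebra : HeytingAlgebra 0ℓ 0ℓ 0ℓ
  open HeytingAlgebra algebra public
  field
    total : Total _≤_

⟦_⟧ : Term → (A : GodelChain) → (ℕ → GodelChain.Carrier A) → GodelChain.Carrier A
⟦ var x ⟧ A ρ   = ρ x
⟦ `0 ⟧ A ρ      = GodelChain.⊥ A
⟦ `1 ⟧ A ρ      = GodelChain.⊤ A
⟦ s `∧ t ⟧ A ρ  = GodelChain._∧_ A (⟦ s ⟧ A ρ) (⟦ t ⟧ A ρ)
⟦ s `∨ t ⟧ A ρ  = GodelChain._∨_ A (⟦ s ⟧ A ρ) (⟦ t ⟧ A ρ)
⟦ s `→ t ⟧ A ρ  = GodelChain._⇨_ A (⟦ s ⟧ A ρ) (⟦ t ⟧ A ρ)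

_≈G_ : Term → Term → Set₁
s ≈G t = (A : GodelChain) (ρ : ℕ → GodelChain.Carrier A) →
         GodelChain._≈_ A (⟦ s ⟧ A ρ) (⟦ t ⟧ A ρ)

_⪯_ : Term → Term → Set₁
s ⪯ u = Σ Subst λ σ → (u [ σ ]) ≈G s

-- A problem is a finite nonempty multiset {t₁,…,tₘ}, given as a list t ∷ ts.
-- s is a solution if each tₖ is an instance σₖ(s) modulo the variety.
IsSolution : Term → List Term → Term → Set₁
IsSolution t ts s = All (λ tₖ → Σ Subst λ σ → (s [ σ ]) ≈G tₖ) (t ∷ ts)

-- Unitary: there is a minimal complete set of cardinality 1, i.e. a solution
-- s such that every solution u lies above it (s ⪯ u). (For a singleton the
-- pairwise-incomparability condition is vacuous.)
Unitary : Term → List Term → Set₁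
Unitary t ts = Σ Term λ s → IsSolution t ts s × ((u : Term) → IsSolution t ts u → s ⪯ u)

UnitaryType : Set₁
UnitaryType = (t : Term) (ts : List Term) → Unitary t ts

-- In a Heyting chain every pseudo-complement ¬ c is ⊥ or ⊤, so the term
-- (¬¬x₀ ∧ a) ∨ (¬x₀ ∧ b) behaves as "if x₀ then a else b": it takes the value of
-- a or of b according to x₀. Hence t₁,…,tₘ have the generalizer
--   g = if x₀ then t₁ else (if x₁ then t₂ else …)
-- (each tₖ with its variables shifted past the selector), which has every tₖ
-- as an instance (send the selectors to 1 or 0). If a solution u has
-- u[σ] = t₁ and u[τ] = the generalizer of the rest, then the substitution
-- x ↦ if x₀ then σ x else τ x sends u to g: g is below every solution.
module Submission where

open import Data.Nat using (ℕ; zero; suc)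
open import Data.List using (List; []; _∷_)
open import Data.List.Relation.Unary.All using ([]; _∷_; map)
open import Data.Product using (_,_)
open import Data.Sum using (_⊎_; inj₁; inj₂)
open import Function using (_∘_)
open import Relation.Binary.Definitions using (Total)
open import Relation.Binary.Lattice.Bundles using (HeytingAlgebra)
open import Relation.Binary.PropositionalEquality as ≡ using (_≡_)
import Relation.Binary.Lattice.Properties.HeytingAlgebra as HeytingProperties
import Relation.Binary.Lattice.Properties.MeetSemilattice as MeetProperties
import Relation.Binary.Lattice.Properties.JoinSemilattice as JoinProperties
import Relation.Binary.Lattice.Properties.BoundedMeetSemilattice as BoundedMeetProperties
import Relation.Binary.Lattice.Properties.BoundedJoinSemilattice as BoundedJoinProperties
import Relation.Binary.Lattice.Properties.BoundedLattice as BoundedProperties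
import Relation.Binary.Reasoning.Setoid as SetoidReasoning

open import Defs

module IfThenElse {c ℓ₁ ℓ₂} (H : HeytingAlgebra c ℓ₁ ℓ₂) where
  open HeytingAlgebra H
  open HeytingProperties H using (¬_; ⇨-eval; ⇨-unit; ⇨-cong)
  open MeetProperties meetSemilattice using (∧-cong)
  open JoinProperties joinSemilattice using (∨-cong)
  open BoundedMeetProperties boundedMeetSemilattice using () renaming (identityˡ to ∧-identityˡ)
  open BoundedJoinProperties boundedJoinSemilattice using () renaming (identityˡ to ∨-identityˡ; identityʳ to ∨-identityʳ)
  open BoundedProperties boundedLattice using (∧-zeroˡ)

  ite : Carrier → Carrier → Carrier → Carrier
  ite x a b = (¬ ¬ x ∧ a) ∨ (¬ x ∧ b)

  ¬⊤≈⊥ : ¬ ⊤ ≈ ⊥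
  ¬⊤≈⊥ = antisym (trans (∧-greatest refl (maximum _)) ⇨-eval) (minimum _)

  ite-then : ∀ {x} a b → ¬ x ≈ ⊥ → ite x a b ≈ a
  ite-then a b ¬x≈⊥ = Eq.trans
    (∨-cong (∧-cong (Eq.trans (⇨-cong ¬x≈⊥ Eq.refl) ⇨-unit) Eq.refl) (∧-cong ¬x≈⊥ Eq.refl))
    (Eq.trans (∨-cong (∧-identityˡ a) (∧-zeroˡ b)) (∨-identityʳ a))

  ite-else : ∀ {x} a b → ¬ x ≈ ⊤ → ite x a b ≈ b
  ite-else a b ¬x≈⊤ = Eq.trans
    (∨-cong (∧-cong (Eq.trans (⇨-cong ¬x≈⊤ Eq.refl) ¬⊤≈⊥) Eq.refl) (∧-cong ¬x≈⊤ Eq.refl))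
    (Eq.trans (∨-cong (∧-zeroˡ a) (∧-identityˡ b)) (∨-identityˡ b))

  ¬≈⊥⊎¬≈⊤ : Total _≤_ → ∀ x → ¬ x ≈ ⊥ ⊎ ¬ x ≈ ⊤
  ¬≈⊥⊎¬≈⊤ total x with total x (¬ x)
  ... | inj₁ x≤¬x = inj₂ (Eq.trans (⇨-cong x≈⊥ Eq.refl) ⇨-unit)
    where
    x≈⊥ : x ≈ ⊥
    x≈⊥ = antisym (trans (∧-greatest x≤¬x refl) ⇨-eval) (minimum _)
  ... | inj₂ ¬x≤x = inj₁ (antisym (trans (∧-greatest refl ¬x≤x) ⇨-eval) (minimum _))

infixr 5 _∷ₛ_
_∷ₛ_ : Term → Subst → Subst
(t ∷ₛ σ) zero    = t
(t ∷ₛ σ) (suc x) = σ x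

↑_ : Term → Term
↑ t = t [ var ∘ suc ]

`¬_ : Term → Term
`¬ t = t `→ `0

if_then_else_ : Term → Term → Term → Term
if x then a else b = ((`¬ `¬ x) `∧ a) `∨ ((`¬ x) `∧ b)

_⊕_ : Subst → Subst → Subst
(σ ⊕ τ) x = if var 0 then ↑ σ x else ↑ τ x

lgg : Term → List Term → Term
lgg t []        = t
lgg t (t′ ∷ ts) = if var 0 then ↑ t else ↑ lgg t′ ts

⟦⟧-[] : ∀ t {A ρ σ} → ⟦ t [ σ ] ⟧ A ρ ≡ ⟦ t ⟧ A (λ x → ⟦ σ x ⟧ A ρ)
⟦⟧-[] (var x)  = ≡.refl
⟦⟧-[] `0       = ≡.refl
⟦⟧-[] `1       = ≡.refl
⟦⟧-[] (s `∧ t) {A} = ≡.cong₂ (GodelChain._∧_ A) (⟦⟧-[] s) (⟦⟧-[] t)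
⟦⟧-[] (s `∨ t) {A} = ≡.cong₂ (GodelChain._∨_ A) (⟦⟧-[] s) (⟦⟧-[] t)
⟦⟧-[] (s `→ t) {A} = ≡.cong₂ (GodelChain._⇨_ A) (⟦⟧-[] s) (⟦⟧-[] t)

module _ (A : GodelChain) where
  open GodelChain A
  open HeytingProperties algebra using (¬_; ⇨-unit; ⇨-cong)
  open MeetProperties meetSemilattice using (∧-cong)
  open JoinProperties joinSemilattice using (∨-cong)
  open IfThenElse algebra using (ite-then; ite-else; ¬⊤≈⊥; ¬≈⊥⊎¬≈⊤)
  open SetoidReasoning setoid

  ⟦⟧-cong : ∀ t {ρ ρ′} → (∀ x → ρ x ≈ ρ′ x) → ⟦ t ⟧ A ρ ≈ ⟦ t ⟧ A ρ′
  ⟦⟧-cong (var x)  ρ≈ρ′ = ρ≈ρ′ x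
  ⟦⟧-cong `0       ρ≈ρ′ = Eq.refl
  ⟦⟧-cong `1       ρ≈ρ′ = Eq.refl
  ⟦⟧-cong (s `∧ t) ρ≈ρ′ = ∧-cong (⟦⟧-cong s ρ≈ρ′) (⟦⟧-cong t ρ≈ρ′)
  ⟦⟧-cong (s `∨ t) ρ≈ρ′ = ∨-cong (⟦⟧-cong s ρ≈ρ′) (⟦⟧-cong t ρ≈ρ′)
  ⟦⟧-cong (s `→ t) ρ≈ρ′ = ⇨-cong (⟦⟧-cong s ρ≈ρ′) (⟦⟧-cong t ρ≈ρ′)

  module _ (ρ : ℕ → Carrier) where

    ⟦if⟧-then : ¬ ρ 0 ≈ ⊥ → ∀ a b → ⟦ if var 0 then ↑ a else ↑ b ⟧ A ρ ≈ ⟦ a ⟧ A (ρ ∘ suc)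
    ⟦if⟧-then ¬ρ₀≈⊥ a b = Eq.trans (ite-then _ _ ¬ρ₀≈⊥) (Eq.reflexive (⟦⟧-[] a))

    ⟦if⟧-else : ¬ ρ 0 ≈ ⊤ → ∀ a b → ⟦ if var 0 then ↑ a else ↑ b ⟧ A ρ ≈ ⟦ b ⟧ A (ρ ∘ suc)
    ⟦if⟧-else ¬ρ₀≈⊤ a b = Eq.trans (ite-else _ _ ¬ρ₀≈⊤) (Eq.reflexive (⟦⟧-[] b))

    ⟦⊕⟧-then : ¬ ρ 0 ≈ ⊥ → ∀ u σ τ → ⟦ u [ σ ⊕ τ ] ⟧ A ρ ≈ ⟦ u [ σ ] ⟧ A (ρ ∘ suc)
    ⟦⊕⟧-then ¬ρ₀≈⊥ u σ τ = begin
      ⟦ u [ σ ⊕ τ ] ⟧ A ρ                          ≡⟨ ⟦⟧-[] u ⟩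
      ⟦ u ⟧ A (λ x → ⟦ (σ ⊕ τ) x ⟧ A ρ)            ≈⟨ ⟦⟧-cong u (λ x → ⟦if⟧-then ¬ρ₀≈⊥ (σ x) (τ x)) ⟩
      ⟦ u ⟧ A (λ x → ⟦ σ x ⟧ A (ρ ∘ suc))          ≡⟨ ≡.sym (⟦⟧-[] u) ⟩
      ⟦ u [ σ ] ⟧ A (ρ ∘ suc)                      ∎

    ⟦⊕⟧-else : ¬ ρ 0 ≈ ⊤ → ∀ u σ τ → ⟦ u [ σ ⊕ τ ] ⟧ A ρ ≈ ⟦ u [ τ ] ⟧ A (ρ ∘ suc)
    ⟦⊕⟧-else ¬ρ₀≈⊤ u σ τ = begin
      ⟦ u [ σ ⊕ τ ] ⟧ A ρ                          ≡⟨ ⟦⟧-[] u ⟩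
      ⟦ u ⟧ A (λ x → ⟦ (σ ⊕ τ) x ⟧ A ρ)            ≈⟨ ⟦⟧-cong u (λ x → ⟦if⟧-else ¬ρ₀≈⊤ (σ x) (τ x)) ⟩
      ⟦ u ⟧ A (λ x → ⟦ τ x ⟧ A (ρ ∘ suc))          ≡⟨ ≡.sym (⟦⟧-[] u) ⟩
      ⟦ u [ τ ] ⟧ A (ρ ∘ suc)                      ∎

  lgg-instance-head : ∀ t t′ ts ρ → ⟦ lgg t (t′ ∷ ts) [ `1 ∷ₛ var ] ⟧ A ρ ≈ ⟦ t ⟧ A ρ
  lgg-instance-head t t′ ts ρ = begin
    ⟦ lgg t (t′ ∷ ts) [ `1 ∷ₛ var ] ⟧ A ρ                ≡⟨ ⟦⟧-[] (lgg t (t′ ∷ ts)) {A} {ρ} ⟩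
    ⟦ lgg t (t′ ∷ ts) ⟧ A (λ x → ⟦ (`1 ∷ₛ var) x ⟧ A ρ) ≈⟨ ⟦if⟧-then _ ¬⊤≈⊥ t (lgg t′ ts) ⟩
    ⟦ t ⟧ A ρ                                            ∎

  lgg-instance-tail : ∀ t t′ ts σ ρ → ⟦ lgg t (t′ ∷ ts) [ `0 ∷ₛ σ ] ⟧ A ρ ≈ ⟦ lgg t′ ts [ σ ] ⟧ A ρ
  lgg-instance-tail t t′ ts σ ρ = begin
    ⟦ lgg t (t′ ∷ ts) [ `0 ∷ₛ σ ] ⟧ A ρ          ≡⟨ ⟦⟧-[] (lgg t (t′ ∷ ts)) {A} {ρ} ⟩
    ⟦ lgg t (t′ ∷ ts) ⟧ A (λ x → ⟦ (`0 ∷ₛ σ) x ⟧ A ρ) ≈⟨ ⟦if⟧-else _ ⇨-unit t (lgg t′ ts) ⟩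
    ⟦ lgg t′ ts ⟧ A (λ x → ⟦ σ x ⟧ A ρ)          ≡⟨ ≡.sym (⟦⟧-[] (lgg t′ ts)) ⟩
    ⟦ lgg t′ ts [ σ ] ⟧ A ρ                      ∎

  ⊕-instance-lgg : ∀ t t′ ts u σ τ → (u [ σ ]) ≈G t → (u [ τ ]) ≈G lgg t′ ts →
                   ∀ ρ → ⟦ u [ σ ⊕ τ ] ⟧ A ρ ≈ ⟦ lgg t (t′ ∷ ts) ⟧ A ρ
  ⊕-instance-lgg t t′ ts u σ τ uσ≈t uτ≈lgg ρ with ¬≈⊥⊎¬≈⊤ total (ρ 0)
  ... | inj₁ ¬ρ₀≈⊥ = Eq.trans (⟦⊕⟧-then ρ ¬ρ₀≈⊥ u σ τ)
    (Eq.trans (uσ≈t A (ρ ∘ suc)) (Eq.sym (⟦if⟧-then ρ ¬ρ₀≈⊥ t (lgg t′ ts))))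
  ... | inj₂ ¬ρ₀≈⊤ = Eq.trans (⟦⊕⟧-else ρ ¬ρ₀≈⊤ u σ τ)
    (Eq.trans (uτ≈lgg A (ρ ∘ suc)) (Eq.sym (⟦if⟧-else ρ ¬ρ₀≈⊤ t (lgg t′ ts))))

lgg-solution : ∀ t ts → IsSolution t ts (lgg t ts)
lgg-solution t []        = (var , λ A ρ → GodelChain.Eq.reflexive A (⟦⟧-[] t)) ∷ []
lgg-solution t (t′ ∷ ts) =
  (`1 ∷ₛ var , λ A → lgg-instance-head A t t′ ts) ∷
  map (λ (σ , lggσ≈tₖ) → `0 ∷ₛ σ , λ A ρ →
         GodelChain.Eq.trans A (lgg-instance-tail A t t′ ts σ ρ) (lggσ≈tₖ A ρ))
      (lgg-solution t′ ts)

lgg-least : ∀ t ts u → IsSolution t ts u → lgg t ts ⪯ u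
lgg-least t []        u (uσ≈t ∷ []) = uσ≈t
lgg-least t (t′ ∷ ts) u ((σ , uσ≈t) ∷ rest) with lgg-least t′ ts u rest
... | τ , uτ≈lgg = σ ⊕ τ , λ A → ⊕-instance-lgg A t t′ ts u σ τ uσ≈t uτ≈lgg

theorem5p3 : UnitaryType
theorem5p3 t ts = lgg t ts , lgg-solution t ts , lgg-least t ts
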